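{- Let $U$ be a countably infinite set and $\mathrm{G}$ a subgroup of $\mathfrak{S}(U)$. If $F$ is a finite subset of a copy $C\in\overline{\mathrm{G}}[U]$, then there exists $f\in\overline{\mathrm{G}}$ with $f[U]=C$ and $f(a)=a$ for all $a\in F$. Equivalently, for every finite $F\subseteq U$, $\overline{\mathrm{G}\langle F\rangle}[U]=\overline{\mathrm{G}}\langle F\rangle[U]=\{C\in\overline{\mathrm{G}}[U]\mid F\subseteq C\}$.
   Context: For $X\subseteq U^U$, $\overline{X}$ is the closure of $X$ in $U^U$ for the function topology (maps $f:U\to U$ such that every finite restriction of $f$ is a restriction of some element of $X$), and $X[U]=\{f[U]\mid f\in X\}$. For $X\subseteq U^U$ and $F\subseteq U$, $X\langle F\rangle=\{f\in X\mid f(x)=x\ \forall x\in F\}$. Copies are the elements of $\overline{\mathrm{G}}[U]$. -}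

module Defs where

open import Data.Nat using (ℕ)
open import Data.Product using (Σ; ∃; _×_; _,_)
open import Data.List using (List)
open import Data.List.Relation.Unary.All using (All)
open import Relation.Binary.PropositionalEquality using (_≡_)
open import Function.Bundles using (_⇔_)

-- The countably infinite set U is taken to be ℕ (every countably infinite
-- set is in bijection with ℕ, and all notions below are transported along
-- such a bijection).

MapSet : Set₁
MapSet = (ℕ → ℕ) → Set

SubsetU : Set₁
SubsetU = ℕ → Set

_≗_ : (ℕ → ℕ) → (ℕ → ℕ) → Set
f ≗ g = ∀ x → f x ≡ g x

IsPerm : (ℕ → ℕ) → Set
IsPerm f = Σ (ℕ → ℕ) λ g → ((λ x → g (f x)) ≗ (λ x → x)) × ((λ x → f (g x)) ≗ (λ x → x))

-- G is a subgroup of 𝔖(U).  Since functions are compared pointwise,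
-- G is required to be a genuine set of maps (closed under ≗).
record IsSubgroup (G : MapSet) : Set where
  field
    respects : ∀ {f g} → f ≗ g → G f → G g
    perm     : ∀ {f} → G f → IsPerm f
    hasId    : G (λ x → x)
    closed∘  : ∀ {f g} → G f → G g → G (λ x → f (g x))
    closed⁻¹ : ∀ {f} → G f → Σ (ℕ → ℕ) λ g → G g × ((λ x → g (f x)) ≗ (λ x → x))

-- Closure of X in U^U (function / pointwise-convergence topology):
-- every finite restriction of f is a restriction of some element of X.
Closure : MapSet → MapSet
Closure X f = (xs : List ℕ) → Σ (ℕ → ℕ) λ g → X g × All (λ x → g x ≡ f x) xs

Image : (ℕ → ℕ) → SubsetU
Image f y = ∃ λ x → f x ≡ y

_≐_ : SubsetU → SubsetU → Set
A ≐ B = ∀ y → A y ⇔ B y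

InImages : MapSet → SubsetU → Set
InImages X C = Σ (ℕ → ℕ) λ f → X f × (Image f ≐ C)

-- Choose preimages bs of the points of F under some f₀ ∈ Ḡ with f₀[U] = C,
-- and g ∈ G agreeing with f₀ on bs.  Then f = f₀ ∘ g⁻¹ lies in Ḡ, has the
-- same image as f₀ because g⁻¹ is onto, and fixes F: for a = f₀ b with b in
-- bs, f a = f₀ (g⁻¹ (g b)) = f₀ b = a.
module Submission where

open import Defs
open import Data.Nat using (ℕ)
open import Data.Product using (Σ; _×_; _,_; proj₁; proj₂)
open import Data.List using (List; []; _∷_; map)
open import Data.List.Relation.Unary.All as All using (All; []; _∷_)
open import Data.List.Relation.Unary.All.Properties using (map⁺; map⁻)
open import Relation.Binary.PropositionalEquality using (_≡_; refl; sym; trans; cong; subst)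
open import Function using (_∘_)
open import Function.Bundles using (mk⇔; Equivalence)
import Function.Properties.Equivalence as ⇔

≐-trans : ∀ {A B C : SubsetU} → A ≐ B → B ≐ C → A ≐ C
≐-trans A≐B B≐C y = ⇔.trans (A≐B y) (B≐C y)

Closure-∘ʳ : ∀ {X : MapSet} {h f : ℕ → ℕ}
  → (∀ {g} → X g → X (g ∘ h)) → Closure X f → Closure X (f ∘ h)
Closure-∘ʳ {h = h} X∘h f∈X̄ xs =
  let g , g∈X , g≈f = f∈X̄ (map h xs) in g ∘ h , X∘h g∈X , map⁻ g≈f

Image-∘-section : ∀ {f h s : ℕ → ℕ} → (∀ x → h (s x) ≡ x) → Image (f ∘ h) ≐ Image f
Image-∘-section {f} {h} {s} hs≗id y =
  mk⇔ (λ (x , fhx≡y) → h x , fhx≡y)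
      (λ (x , fx≡y) → s x , trans (cong f (hs≗id x)) fx≡y)

preimages : ∀ {f : ℕ → ℕ} {F : List ℕ} → All (Image f) F
  → Σ (List ℕ) λ bs → map f bs ≡ F
preimages [] = [] , refl
preimages {f} ((b , refl) ∷ F⊆Imf) =
  let bs , fbs≡F = preimages F⊆Imf in b ∷ bs , cong (f b ∷_) fbs≡F

∘-left-inverse-fixes-image : ∀ {f g h : ℕ → ℕ} {bs : List ℕ}
  → All (λ b → g b ≡ f b) bs → (∀ x → h (g x) ≡ x)
  → All (λ a → f (h a) ≡ a) (map f bs)
∘-left-inverse-fixes-image {f} {h = h} g≈f hg≗id =
  map⁺ (All.map (λ {b} gb≡fb → cong f (trans (cong h (sym gb≡fb)) (hg≗id b))) g≈f)

lemma3p4 : (G : MapSet) → IsSubgroup G → (C : SubsetU) → InImages (Closure G) C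
    → (F : List ℕ) → All C F
    → Σ (ℕ → ℕ) λ f → Closure G f × (Image f ≐ C) × All (λ a → f a ≡ a) F
lemma3p4 G sg C (f₀ , f₀∈Ḡ , Imf₀≐C) F F⊆C =
  f₀ ∘ g⁻¹ ,
  Closure-∘ʳ (λ h∈G → closed∘ h∈G g⁻¹∈G) f₀∈Ḡ ,
  ≐-trans (Image-∘-section g⁻¹g≗id) Imf₀≐C ,
  subst (All _) f₀bs≡F (∘-left-inverse-fixes-image g≈f₀ g⁻¹g≗id)
  where
  open IsSubgroup sg
  F⊆Imf₀ : All (Image f₀) F
  F⊆Imf₀ = All.map (λ {a} a∈C → Equivalence.from (Imf₀≐C a) a∈C) F⊆C
  preimagesF = preimages F⊆Imf₀
  bs = proj₁ preimagesF
  f₀bs≡F = proj₂ preimagesF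
  approximant = f₀∈Ḡ bs
  g = proj₁ approximant
  g≈f₀ = proj₂ (proj₂ approximant)
  inverse = closed⁻¹ (proj₁ (proj₂ approximant))
  g⁻¹ = proj₁ inverse
  g⁻¹∈G = proj₁ (proj₂ inverse)
  g⁻¹g≗id = proj₂ (proj₂ inverse)
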